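{- Let $\vec\alpha=(\alpha_i)_{i\in\omega}$ be a suitable sequence of ordinals $\le\varepsilon_0$. Then the set $F_{\vec\alpha}:=\{\vec\beta\in I:\forall i\in\omega\ \alpha_i>\beta_i\}$ is a filter in the Ignatiev algebra $\mathfrak{I}$.
   Context: Ordinal conventions: $\varepsilon_0$ is the least ordinal $\varepsilon$ with $\omega^\varepsilon=\varepsilon$. For an ordinal $\alpha>0$, $\ell(\alpha)$ is the unique $\beta$ such that $\alpha=\gamma+\omega^\beta$ for some $\gamma$. Also $\ell(0)=0$. Ignatiev sequences: $I$ is the set of sequences $\vec\alpha=(\alpha_i)_{i\in\omega}$ of ordinals $<\varepsilon_0$ with $\alpha_{i+1}\le\ell(\alpha_i)$ for all $i$. Ignatiev algebra $\mathfrak{I}$: its universe is $I$. The order is $\vec\alpha\le_\mathfrak{I}\vec\beta$ iff $\alpha_i\ge\beta_i$ for all $i$. The meet $\vec\alpha\land_\mathfrak{I}\vec\beta$ is the $\le_\mathfrak{I}$-greatest lower bound. Explicitly, put $\gamma_i=\max(\alpha_i,\beta_i)$ and take $N$ with $\gamma_i=0$ for $i\ge N$. Then $\vec\delta=\vec\alpha\land_\mathfrak{I}\vec\beta$ has $\delta_i=0$ for $i\ge N$, and downward for $i<N$: $\delta_i=\gamma_i$ if $\ell(\gamma_i)\ge\delta_{i+1}$, and $\delta_i=\gamma_i+\omega^{\delta_{i+1}}$ otherwise. Filters: a filter in $\mathfrak{I}$ is a nonempty $F\subseteq I$ that is upward closed under $\le_\mathfrak{I}$ and closed under $\land_\mathfrak{I}$.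 Suitable sequences: a sequence $\vec\alpha$ of ordinals $\le\varepsilon_0$ is suitable if for every $i\in\omega$ one of the following holds: - $\alpha_i$ is a limit ordinal and $\alpha_{i+1}\le\ell(\alpha_i)$; or - $\alpha_i=\alpha_i'+1$ for some $\alpha_i'$, and $\alpha_{i+1}\le\ell(\alpha_i')+1$. -}

module Defs where

open import Data.Nat using (ℕ; suc)
open import Data.Bool using (Bool; true; false; if_then_else_)
open import Data.Product using (Σ; _×_; ∃)
open import Data.Sum using (_⊎_)
open import Data.Unit using (⊤)
open import Data.Empty using (⊥)
open import Relation.Binary.PropositionalEquality using (_≡_; _≢_)
open import Relation.Nullary using (¬_)

-- Ordinals below ε₀ in Cantor normal form.
-- ω^ a + b  denotes  ω^a + b ; a term is meaningful when it is in
-- normal form (NF): exponents non-increasing, hereditarily.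
-- For NF terms, syntactic equality is ordinal equality.

data Cnf : Set where
  𝟎     : Cnf
  ω^_+_ : Cnf → Cnf → Cnf

-- Boolean strict comparison (correct on normal forms).
_<ᵇ_ : Cnf → Cnf → Bool
𝟎 <ᵇ 𝟎 = false
𝟎 <ᵇ (ω^ _ + _) = true
(ω^ _ + _) <ᵇ 𝟎 = false
(ω^ a + b) <ᵇ (ω^ c + d) =
  if a <ᵇ c then true else (if c <ᵇ a then false else b <ᵇ d)

_<_ : Cnf → Cnf → Set
a < b = (a <ᵇ b) ≡ true

_≤_ : Cnf → Cnf → Set
a ≤ b = a < b ⊎ a ≡ b

data NF : Cnf → Set where
  nf𝟎 : NF 𝟎
  nf₁ : ∀ {a} → NF a → NF (ω^ a + 𝟎)
  nf₂ : ∀ {a c d} → NF a → NF (ω^ c + d) → c ≤ a → NF (ω^ a + (ω^ c + d))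

ℓ : Cnf → Cnf
ℓ 𝟎 = 𝟎
ℓ (ω^ a + 𝟎) = a
ℓ (ω^ a + (ω^ c + d)) = ℓ (ω^ c + d)

-- α + ω^β  (ordinal addition, on normal forms).
_+ω^_ : Cnf → Cnf → Cnf
𝟎 +ω^ b = ω^ b + 𝟎
(ω^ a + r) +ω^ b = if a <ᵇ b then ω^ b + 𝟎 else ω^ a + (r +ω^ b)

suc₀ : Cnf → Cnf
suc₀ a = a +ω^ 𝟎

Seq : Set
Seq = ℕ → Cnf

IsIgn : Seq → Set
IsIgn β = (∀ i → NF (β i)) × (∀ i → β (suc i) ≤ ℓ (β i))

_≤I_ : Seq → Seq → Set
β ≤I γ = ∀ i → γ i ≤ β i

IsMeet : Seq → Seq → Seq → Set
IsMeet δ β γ =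
  IsIgn δ × δ ≤I β × δ ≤I γ ×
  (∀ η → IsIgn η → η ≤I β → η ≤I γ → η ≤I δ)

IsFilter : (Seq → Set) → Set
IsFilter F =
  (∀ β → F β → IsIgn β) ×
  (∃ λ β → F β) ×
  (∀ β γ → F β → IsIgn γ → β ≤I γ → F γ) ×
  (∀ β γ δ → F β → F γ → IsMeet δ β γ → F δ)

data Ord≤ε₀ : Set where
  fin : Cnf → Ord≤ε₀
  ε₀  : Ord≤ε₀

WF : Ord≤ε₀ → Set
WF (fin a) = NF a
WF ε₀ = ⊤

_<E_ : Ord≤ε₀ → Ord≤ε₀ → Set
fin a <E fin b = a < b
fin _ <E ε₀ = ⊤
ε₀ <E _ = ⊥

_≤E_ : Ord≤ε₀ → Ord≤ε₀ → Set
a ≤E b = a <E b ⊎ a ≡ b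

-- ℓ on ordinals ≤ ε₀ ; ℓ(ε₀) = ε₀ since ε₀ = ω^ε₀.
ℓE : Ord≤ε₀ → Ord≤ε₀
ℓE (fin a) = fin (ℓ a)
ℓE ε₀ = ε₀

IsSuccessor : Ord≤ε₀ → Set
IsSuccessor a = Σ Cnf λ a' → NF a' × a ≡ fin (suc₀ a')

IsLimit : Ord≤ε₀ → Set
IsLimit a = a ≢ fin 𝟎 × ¬ IsSuccessor a

SuitableStep : Ord≤ε₀ → Ord≤ε₀ → Set
SuitableStep a b =
  (IsLimit a × b ≤E ℓE a) ⊎
  (Σ Cnf λ a' → NF a' × a ≡ fin (suc₀ a') × b ≤E fin (suc₀ (ℓ a')))

Suitable : (ℕ → Ord≤ε₀) → Set
Suitable α = (∀ i → WF (α i)) × (∀ i → SuitableStep (α i) (α (suc i)))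

Fα : (ℕ → Ord≤ε₀) → Seq → Set
Fα α β = IsIgn β × (∀ i → fin (β i) <E α i)

module Submission where

-- Membership in I, nonemptiness (the zero sequence: every term of a
-- suitable sequence is positive) and upward closure are immediate.  The
-- content is closure under meets.  Write g ⊔ h for the maximum and
--   meetStep g d = g        if d ≤ ℓ(g),
--                  g + ω^d  otherwise,
-- the least ordinal x ≥ g with d ≤ ℓ(x).  If δ = β ∧ γ, then replacing δ_i
-- by meetStep (β_i ⊔ γ_i) δ_{i+1} gives another lower bound of β and γ in I,
-- so δ_i ≤ meetStep (β_i ⊔ γ_i) δ_{i+1} by maximality of δ.  The key
-- arithmetic fact is that a suitable step α_i → α_{i+1} is what makes
-- meetStep g d < α_i whenever g < α_i and d < α_{i+1}.  Hence
-- δ_{i+1} < α_{i+1} implies δ_i < α_i, and this downward induction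
-- terminates because along an Ignatiev sequence the height of the
-- exponent tower strictly drops until the terms become 0.

open import Defs
open import Data.Nat as ℕ using (ℕ; suc; _≟_; s≤s)
import Data.Nat.Properties as ℕ
open import Data.Bool using (Bool; true; false; if_then_else_)
open import Data.Product using (∃; _×_; _,_; proj₁)
open import Data.Sum using (_⊎_; inj₁; inj₂)
open import Data.Unit using (tt)
open import Data.Empty using (⊥; ⊥-elim)
open import Relation.Binary.PropositionalEquality
  using (_≡_; _≢_; refl; sym; trans; cong; cong₂; subst)
open import Relation.Nullary using (yes; no)

-- The order on Cantor normal forms

-- Defs' `x < y` is the computed equation `(x <ᵇ y) ≡ true`, from which
-- Agda cannot recover x and y; these wrappers make the arguments inferable.
data _≺_ (x y : Cnf) : Set where
  mk≺ : x < y → x ≺ y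

data _≼_ (x y : Cnf) : Set where
  strict : x ≺ y → x ≼ y
  same   : x ≡ y → x ≼ y

from≺ : ∀ {x y} → x ≺ y → x < y
from≺ (mk≺ p) = p

to≼ : ∀ {x y} → x ≤ y → x ≼ y
to≼ (inj₁ p) = strict (mk≺ p)
to≼ (inj₂ p) = same p

from≼ : ∀ {x y} → x ≼ y → x ≤ y
from≼ (strict p) = inj₁ (from≺ p)
from≼ (same p)   = inj₂ p

not-both : ∀ {b : Bool} → b ≡ true → b ≡ false → ⊥
not-both refl ()

<ᵇ-irrefl : ∀ x → (x <ᵇ x) ≡ false
<ᵇ-irrefl 𝟎 = refl
<ᵇ-irrefl (ω^ a + b) rewrite <ᵇ-irrefl a = <ᵇ-irrefl b

<ᵇ-connex : ∀ x y → (x <ᵇ y) ≡ false → (y <ᵇ x) ≡ false → x ≡ y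
<ᵇ-connex 𝟎 𝟎 _ _ = refl
<ᵇ-connex 𝟎 (ω^ _ + _) () _
<ᵇ-connex (ω^ _ + _) 𝟎 _ ()
<ᵇ-connex (ω^ a + b) (ω^ c + d) p q with a <ᵇ c in a<c | c <ᵇ a in c<a
... | true  | _     = ⊥-elim (not-both refl p)
... | false | true  = ⊥-elim (not-both refl q)
... | false | false = cong₂ ω^_+_ (<ᵇ-connex a c a<c c<a) (<ᵇ-connex b d p q)

≺-irrefl : ∀ {x} → x ≺ x → ⊥
≺-irrefl {x} (mk≺ p) = not-both p (<ᵇ-irrefl x)

≮𝟎 : ∀ {x} → x ≺ 𝟎 → ⊥
≮𝟎 {𝟎} (mk≺ ())
≮𝟎 {ω^ _ + _} (mk≺ ())

𝟎≺ω^ : ∀ {a b} → 𝟎 ≺ (ω^ a + b)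
𝟎≺ω^ = mk≺ refl

≺-ω^-inv : ∀ {a b c d} → (ω^ a + b) ≺ (ω^ c + d) → a ≺ c ⊎ (a ≡ c × b ≺ d)
≺-ω^-inv {a} {b} {c} {d} (mk≺ p) with a <ᵇ c in a<c | c <ᵇ a in c<a
... | true  | _     = inj₁ (mk≺ a<c)
... | false | true  = ⊥-elim (not-both p refl)
... | false | false = inj₂ (<ᵇ-connex a c a<c c<a , mk≺ p)

≺-head : ∀ {a b c d} → a ≺ c → (ω^ a + b) ≺ (ω^ c + d)
≺-head {a} {b} {c} {d} (mk≺ a<c) = mk≺ (decide a<c)
  where
  decide : (a <ᵇ c) ≡ true → (ω^ a + b) < (ω^ c + d)
  decide a<c rewrite a<c = refl

≺-tail : ∀ {a b d} → b ≺ d → (ω^ a + b) ≺ (ω^ a + d)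
≺-tail {a} {b} {d} (mk≺ b<d) = mk≺ (decide b<d)
  where
  decide : (b <ᵇ d) ≡ true → (ω^ a + b) < (ω^ a + d)
  decide b<d rewrite <ᵇ-irrefl a = b<d

≺-trans : ∀ {x y z} → x ≺ y → y ≺ z → x ≺ z
≺-trans {𝟎} {_} {𝟎} _ q = ⊥-elim (≮𝟎 q)
≺-trans {𝟎} {_} {ω^ _ + _} _ _ = 𝟎≺ω^
≺-trans {ω^ _ + _} {𝟎} p _ = ⊥-elim (≮𝟎 p)
≺-trans {ω^ _ + _} {ω^ _ + _} {𝟎} _ q = ⊥-elim (≮𝟎 q)
≺-trans {ω^ _ + _} {ω^ _ + _} {ω^ _ + _} p q with ≺-ω^-inv p | ≺-ω^-inv q
... | inj₁ a<c         | inj₁ c<e         = ≺-head (≺-trans a<c c<e)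
... | inj₁ a<c         | inj₂ (refl , _)  = ≺-head a<c
... | inj₂ (refl , _)  | inj₁ c<e         = ≺-head c<e
... | inj₂ (refl , b<d) | inj₂ (refl , d<f) = ≺-tail (≺-trans b<d d<f)

≮⇒≽ : ∀ {x y} → (x <ᵇ y) ≡ false → y ≼ x
≮⇒≽ {x} {y} x≮y with y <ᵇ x in y<x
... | true  = strict (mk≺ y<x)
... | false = same (<ᵇ-connex y x y<x x≮y)

≼-trans : ∀ {x y z} → x ≼ y → y ≼ z → x ≼ z
≼-trans (strict p) (strict q) = strict (≺-trans p q)
≼-trans (strict p) (same refl) = strict p
≼-trans (same refl) q = q

≼-≺-trans : ∀ {x y z} → x ≼ y → y ≺ z → x ≺ z
≼-≺-trans (strict p) q = ≺-trans p q
≼-≺-trans (same refl) q = q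

≺-≼-trans : ∀ {x y z} → x ≺ y → y ≼ z → x ≺ z
≺-≼-trans p (strict q) = ≺-trans p q
≺-≼-trans p (same refl) = p

_⊔_ : Cnf → Cnf → Cnf
x ⊔ y = if x <ᵇ y then y else x

⊔-upperˡ : ∀ x y → x ≼ (x ⊔ y)
⊔-upperˡ x y with x <ᵇ y in x<y
... | true  = strict (mk≺ x<y)
... | false = same refl

⊔-upperʳ : ∀ x y → y ≼ (x ⊔ y)
⊔-upperʳ x y with x <ᵇ y in x<y
... | true  = same refl
... | false = ≮⇒≽ x<y

⊔-preserves : ∀ (Q : Cnf → Set) x y → Q x → Q y → Q (x ⊔ y)
⊔-preserves Q x y qx qy with x <ᵇ y
... | true  = qy
... | false = qx

nf-head : ∀ {a r} → NF (ω^ a + r) → NF a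
nf-head (nf₁ na) = na
nf-head (nf₂ na _ _) = na

nf-tail : ∀ {a r} → NF (ω^ a + r) → NF r
nf-tail (nf₁ _) = nf𝟎
nf-tail (nf₂ _ nr _) = nr

nf-ℓ : ∀ {x} → NF x → NF (ℓ x)
nf-ℓ nf𝟎 = nf𝟎
nf-ℓ (nf₁ na) = na
nf-ℓ (nf₂ _ nr _) = nf-ℓ nr

-- In a normal form the exponents decrease, so the last is at most the first.
ℓ≼head : ∀ {a r} → NF (ω^ a + r) → ℓ (ω^ a + r) ≼ a
ℓ≼head (nf₁ _) = same refl
ℓ≼head (nf₂ _ nr c≤a) = ≼-trans (ℓ≼head nr) (to≼ c≤a)

ℓ-ω^ : ∀ a y → y ≢ 𝟎 → ℓ (ω^ a + y) ≡ ℓ y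
ℓ-ω^ a 𝟎 y≢𝟎 = ⊥-elim (y≢𝟎 refl)
ℓ-ω^ a (ω^ _ + _) _ = refl

isZero : ∀ x → x ≡ 𝟎 ⊎ x ≢ 𝟎
isZero 𝟎 = inj₁ refl
isZero (ω^ _ + _) = inj₂ (λ ())

+ω^-≢𝟎 : ∀ g d → (g +ω^ d) ≢ 𝟎
+ω^-≢𝟎 𝟎 d ()
+ω^-≢𝟎 (ω^ a + _) d with a <ᵇ d
... | true  = λ ()
... | false = λ ()

ℓ-+ω^ : ∀ g d → ℓ (g +ω^ d) ≡ d
ℓ-+ω^ 𝟎 d = refl
ℓ-+ω^ (ω^ a + r) d with a <ᵇ d
... | true  = refl
... | false = trans (ℓ-ω^ a (r +ω^ d) (+ω^-≢𝟎 r d)) (ℓ-+ω^ r d)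

≺-+ω^ : ∀ g d → g ≺ (g +ω^ d)
≺-+ω^ 𝟎 d = 𝟎≺ω^
≺-+ω^ (ω^ a + r) d with a <ᵇ d in a<d
... | true  = ≺-head (mk≺ a<d)
... | false = ≺-tail (≺-+ω^ r d)

nf-+ω^ : ∀ {g d} → NF g → NF d → NF (g +ω^ d)
nf-+ω^ nf𝟎 nd = nf₁ nd
nf-+ω^ {ω^ a + 𝟎} {d} (nf₁ na) nd with a <ᵇ d in a<d
... | true  = nf₁ nd
... | false = nf₂ na (nf₁ nd) (from≼ (≮⇒≽ a<d))
nf-+ω^ {ω^ a + (ω^ c + _)} {d} (nf₂ na nr c≤a) nd with a <ᵇ d in a<d
... | true  = nf₁ nd
... | false with c <ᵇ d | nf-+ω^ nr nd
...   | true  | _       = nf₂ na (nf₁ nd) (from≼ (≮⇒≽ a<d))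
...   | false | nf-tail′ = nf₂ na nf-tail′ c≤a

ω^-≼ : ∀ {d c s} → d ≼ c → (ω^ d + 𝟎) ≼ (ω^ c + s)
ω^-≼ (strict d<c) = strict (≺-head d<c)
ω^-≼ {s = 𝟎} (same refl) = same refl
ω^-≼ {s = ω^ _ + _} (same refl) = strict (≺-tail 𝟎≺ω^)

+ω^-≼ : ∀ {g a d} → NF a → g ≺ a → d ≼ ℓ a → (g +ω^ d) ≼ a
+ω^-≼ {a = 𝟎} _ g<a _ = ⊥-elim (≮𝟎 g<a)
+ω^-≼ {𝟎} {ω^ _ + _} na _ d≤ℓa = ω^-≼ (≼-trans d≤ℓa (ℓ≼head na))
+ω^-≼ {ω^ e + r} {ω^ c + s} {d} na g<a d≤ℓa with ≺-ω^-inv g<a | e <ᵇ d in e<d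
... | inj₁ _ | true = ω^-≼ (≼-trans d≤ℓa (ℓ≼head na))
... | inj₁ e<c | false = strict (≺-head e<c)
... | inj₂ (refl , _) | true =
  ⊥-elim (≺-irrefl (≼-≺-trans (≼-trans d≤ℓa (ℓ≼head na)) (mk≺ e<d)))
... | inj₂ (refl , r<s) | false
  with +ω^-≼ (nf-tail na) r<s (subst (d ≼_) (ℓ-ω^ e s (λ { refl → ≮𝟎 r<s })) d≤ℓa)
...   | strict lt = strict (≺-tail lt)
...   | same eq   = same (cong (ω^_+_ e) eq)

-- With d < ℓ(a) the sum stays strictly below a, as its last exponent is d.
+ω^-≺ : ∀ {g a d} → NF a → g ≺ a → d ≺ ℓ a → (g +ω^ d) ≺ a
+ω^-≺ {g} {d = d} na g<a d<ℓa with +ω^-≼ na g<a (strict d<ℓa)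
... | strict lt = lt
... | same refl = ⊥-elim (≺-irrefl (subst (d ≺_) (ℓ-+ω^ g d) d<ℓa))

𝟎-minimal : ∀ c → (c <ᵇ 𝟎) ≡ false
𝟎-minimal 𝟎 = refl
𝟎-minimal (ω^ _ + _) = refl

suc₀-ω^ : ∀ c s → suc₀ (ω^ c + s) ≡ ω^ c + suc₀ s
suc₀-ω^ c s rewrite 𝟎-minimal c = refl

≺suc₀⇒≼ : ∀ {g a} → g ≺ suc₀ a → g ≼ a
≺suc₀⇒≼ {𝟎} {𝟎} _ = same refl
≺suc₀⇒≼ {ω^ _ + _} {𝟎} g<1 with ≺-ω^-inv g<1
... | inj₁ e<0 = ⊥-elim (≮𝟎 e<0)
... | inj₂ (_ , r<0) = ⊥-elim (≮𝟎 r<0)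
≺suc₀⇒≼ {𝟎} {ω^ _ + _} _ = strict 𝟎≺ω^
≺suc₀⇒≼ {ω^ e + r} {ω^ c + s} g<a+1
  with ≺-ω^-inv (subst ((ω^ e + r) ≺_) (suc₀-ω^ c s) g<a+1)
... | inj₁ e<c = strict (≺-head e<c)
... | inj₂ (refl , r<s+1) with ≺suc₀⇒≼ {r} {s} r<s+1
...   | strict lt = strict (≺-tail lt)
...   | same eq   = same (cong (ω^_+_ e) eq)

-- The local meet step

-- The least x ≥ g with d ≤ ℓ(x); this is how the meet in 𝔍 computes δ_i
-- from max(β_i, γ_i) and δ_{i+1}.
meetStep : Cnf → Cnf → Cnf
meetStep g d = if ℓ g <ᵇ d then g +ω^ d else g

nf-meetStep : ∀ {g d} → NF g → NF d → NF (meetStep g d)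
nf-meetStep {g} {d} ng nd with ℓ g <ᵇ d
... | true  = nf-+ω^ ng nd
... | false = ng

≼-meetStep : ∀ g d → g ≼ meetStep g d
≼-meetStep g d with ℓ g <ᵇ d
... | true  = strict (≺-+ω^ g d)
... | false = same refl

ℓ-meetStep : ∀ g d → d ≼ ℓ (meetStep g d)
ℓ-meetStep g d with ℓ g <ᵇ d in ℓg<d
... | true  = same (sym (ℓ-+ω^ g d))
... | false = ≮⇒≽ ℓg<d

meetStep-least : ∀ {x g d} → NF x → g ≼ x → d ≼ ℓ x → meetStep g d ≼ x
meetStep-least {g = g} {d} nx g≤x d≤ℓx with ℓ g <ᵇ d in ℓg<d | g≤x
... | false | _ = g≤x
... | true | strict g<x = +ω^-≼ nx g<x d≤ℓx
... | true | same refl = ⊥-elim (≺-irrefl (≼-≺-trans d≤ℓx (mk≺ ℓg<d)))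

-- Suitable steps bound the meet step

≼-<E-trans : ∀ {x y A} → x ≼ y → fin y <E A → fin x <E A
≼-<E-trans {A = fin _} x≤y y<A = from≺ (≼-≺-trans x≤y (mk≺ y<A))
≼-<E-trans {A = ε₀} _ _ = tt

≤E-fin : ∀ {d B c} → fin d <E B → B ≤E fin c → d ≺ c
≤E-fin {B = fin _} d<B (inj₁ B<c) = ≺-trans (mk≺ d<B) (mk≺ B<c)
≤E-fin {B = fin _} d<B (inj₂ refl) = mk≺ d<B
≤E-fin {B = ε₀} _ (inj₁ ())
≤E-fin {B = ε₀} _ (inj₂ ())

suitable-positive : ∀ {A B} → WF A → SuitableStep A B → fin 𝟎 <E A
suitable-positive {ε₀} _ _ = tt
suitable-positive {fin (ω^ _ + _)} _ _ = refl
suitable-positive {fin 𝟎} _ (inj₁ ((A≢0 , _) , _)) = ⊥-elim (A≢0 refl)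
suitable-positive {fin 𝟎} _ (inj₂ (a' , _ , A≡a'+1 , _)) =
  ⊥-elim (+ω^-≢𝟎 a' 𝟎 (cong unfin (sym A≡a'+1)))
  where
  unfin : Ord≤ε₀ → Cnf
  unfin (fin a) = a
  unfin ε₀ = 𝟎

+ω^-below-suitable : ∀ {g d A B} → WF A → SuitableStep A B →
  fin g <E A → fin d <E B → ℓ g ≺ d → fin (g +ω^ d) <E A
+ω^-below-suitable {A = ε₀} _ _ _ _ _ = tt
+ω^-below-suitable {g} {A = fin _} na (inj₁ (_ , B≤ℓa)) g<a d<B _ =
  from≺ (+ω^-≺ na (mk≺ {g} g<a) (≤E-fin d<B B≤ℓa))
+ω^-below-suitable {g} {d} {A = fin _} _ (inj₂ (a' , na' , refl , B≤ℓa'+1)) g<a d<B ℓg<d =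
  from≺ (≼-≺-trans (sum≼a' (≺suc₀⇒≼ {g} {a'} (mk≺ g<a))) (≺-+ω^ a' 𝟎))
  where
  d≼ℓa' : d ≼ ℓ a'
  d≼ℓa' = ≺suc₀⇒≼ (≤E-fin d<B B≤ℓa'+1)

  -- g = a' is impossible, as ℓ(g) < d ≤ ℓ(a').
  sum≼a' : g ≼ a' → (g +ω^ d) ≼ a'
  sum≼a' (strict g<a') = +ω^-≼ na' g<a' d≼ℓa'
  sum≼a' (same refl) = ⊥-elim (≺-irrefl (≼-≺-trans d≼ℓa' ℓg<d))

meetStep-below : ∀ {g d A B} → WF A → SuitableStep A B →
  fin g <E A → fin d <E B → fin (meetStep g d) <E A
meetStep-below {g} {d} wA step g<A d<B with ℓ g <ᵇ d in ℓg<d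
... | true  = +ω^-below-suitable wA step g<A d<B (mk≺ ℓg<d)
... | false = g<A

-- Descent along Ignatiev sequences

height : Cnf → ℕ
height 𝟎 = 0
height (ω^ a + _) = suc (height a)

height-mono : ∀ {y z} → NF y → NF z → y ≼ z → height y ℕ.≤ height z
height-mono _ _ (same refl) = ℕ.≤-refl
height-mono {𝟎} _ _ (strict _) = ℕ.z≤n
height-mono {ω^ _ + _} {𝟎} _ _ (strict y<0) = ⊥-elim (≮𝟎 y<0)
height-mono {ω^ _ + _} {ω^ _ + _} ny nz (strict y<z) with ≺-ω^-inv y<z
... | inj₁ a<c = s≤s (height-mono (nf-head ny) (nf-head nz) (strict a<c))
... | inj₂ (refl , _) = ℕ.≤-refl

height-below-ℓ : ∀ {x y} → NF x → NF y → x ≢ 𝟎 → y ≼ ℓ x → height y ℕ.< height x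
height-below-ℓ {𝟎} _ _ x≢0 _ = ⊥-elim (x≢0 refl)
height-below-ℓ {ω^ _ + _} nx ny _ y≤ℓx =
  s≤s (ℕ.≤-trans (height-mono ny (nf-ℓ nx) y≤ℓx)
                 (height-mono (nf-ℓ nx) (nf-head nx) (ℓ≼head nx)))

ignatiev-descent : ∀ {δ} (P : ℕ → Set) → IsIgn δ →
  (∀ i → δ i ≡ 𝟎 → P i) → (∀ i → P (suc i) → P i) → ∀ i → P i
ignatiev-descent {δ} P (nf , chain) base step i = go (suc (height (δ i))) i ℕ.≤-refl
  where
  go : ∀ n i → height (δ i) ℕ.< n → P i
  go (suc n) i (s≤s hδi≤n) with isZero (δ i)
  ... | inj₁ δi≡0 = base i δi≡0
  ... | inj₂ δi≢0 = step i (go n (suc i)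
        (ℕ.≤-trans (height-below-ℓ (nf i) (nf (suc i)) δi≢0 (to≼ (chain i))) hδi≤n))

replaceAt : Seq → ℕ → Cnf → Seq
replaceAt s i c j with j ≟ i
... | yes _ = c
... | no _  = s j

replaceAt-here : ∀ s i c → replaceAt s i c i ≡ c
replaceAt-here s i c with i ≟ i
... | yes _ = refl
... | no i≢i = ⊥-elim (i≢i refl)

-- Replacing s_i by c keeps the sequence in I provided c ≤ s_i (so the link
-- from s_{i-1} survives) and s_{i+1} ≤ ℓ(c).
replaceAt-ign : ∀ s i c → IsIgn s → NF c → c ≼ s i → s (suc i) ≼ ℓ c →
  IsIgn (replaceAt s i c)
replaceAt-ign s i c (nf , chain) nc c≤si si+1≤ℓc = nf′ , chain′
  where
  nf′ : ∀ j → NF (replaceAt s i c j)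
  nf′ j with j ≟ i
  ... | yes _ = nc
  ... | no _  = nf j

  chain′ : ∀ j → replaceAt s i c (suc j) ≤ ℓ (replaceAt s i c j)
  chain′ j with j ≟ i | suc j ≟ i
  ... | yes refl | yes ()
  ... | yes refl | no _ = from≼ si+1≤ℓc
  ... | no _ | yes refl = from≼ (≼-trans c≤si (to≼ (chain j)))
  ... | no _ | no _ = chain j

replaceAt-≤I : ∀ s i c t → s ≤I t → t i ≼ c → replaceAt s i c ≤I t
replaceAt-≤I s i c t s≤t ti≤c j with j ≟ i
... | yes refl = from≼ ti≤c
... | no _ = s≤t j

-- The filter F_α

meet-below-meetStep : ∀ {β γ δ} → IsIgn β → IsIgn γ → IsMeet δ β γ →
  ∀ i → δ i ≼ meetStep (β i ⊔ γ i) (δ (suc i))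
meet-below-meetStep {β} {γ} {δ} (nfβ , _) (nfγ , _)
                    (ignδ@(nfδ , chainδ) , δ≤β , δ≤γ , greatest) i =
  subst (δ i ≼_) (replaceAt-here δ i c) (to≼ (greatest η η-ign η≤β η≤γ i))
  where
  g = β i ⊔ γ i
  c = meetStep g (δ (suc i))
  η = replaceAt δ i c

  g≤δi : g ≼ δ i
  g≤δi = ⊔-preserves (_≼ δ i) (β i) (γ i) (to≼ (δ≤β i)) (to≼ (δ≤γ i))

  η-ign : IsIgn η
  η-ign = replaceAt-ign δ i c ignδ
    (nf-meetStep (⊔-preserves NF (β i) (γ i) (nfβ i) (nfγ i)) (nfδ (suc i)))
    (meetStep-least (nfδ i) g≤δi (to≼ (chainδ i)))
    (ℓ-meetStep g (δ (suc i)))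

  η≤β : η ≤I β
  η≤β = replaceAt-≤I δ i c β δ≤β (≼-trans (⊔-upperˡ (β i) (γ i)) (≼-meetStep g _))

  η≤γ : η ≤I γ
  η≤γ = replaceAt-≤I δ i c γ δ≤γ (≼-trans (⊔-upperʳ (β i) (γ i)) (≼-meetStep g _))

Fα-nonempty : ∀ {α} → Suitable α → ∃ (Fα α)
Fα-nonempty (wf , step) =
  (λ _ → 𝟎) , ((λ _ → nf𝟎) , (λ _ → inj₂ refl)) , λ i → suitable-positive (wf i) (step i)

Fα-upward : ∀ α β γ → Fα α β → IsIgn γ → β ≤I γ → Fα α γ
Fα-upward α β γ (_ , β<α) ign-γ β≤γ = ign-γ , λ i → ≼-<E-trans (to≼ (β≤γ i)) (β<α i)

Fα-meet : ∀ {α} → Suitable α → ∀ β γ δ → Fα α β → Fα α γ → IsMeet δ β γ → Fα α δ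
Fα-meet {α} (wf , step) β γ δ (ignβ , β<α) (ignγ , γ<α) meet@(ignδ , _) =
  ignδ , ignatiev-descent (λ i → fin (δ i) <E α i) ignδ vanishing propagate
  where
  vanishing : ∀ i → δ i ≡ 𝟎 → fin (δ i) <E α i
  vanishing i δi≡0 =
    subst (λ x → fin x <E α i) (sym δi≡0) (suitable-positive (wf i) (step i))

  propagate : ∀ i → fin (δ (suc i)) <E α (suc i) → fin (δ i) <E α i
  propagate i δi+1<α =
    ≼-<E-trans (meet-below-meetStep ignβ ignγ meet i)
      (meetStep-below (wf i) (step i)
        (⊔-preserves (λ x → fin x <E α i) (β i) (γ i) (β<α i) (γ<α i)) δi+1<α)

mainTheorem5 : (α : ℕ → Ord≤ε₀) → Suitable α → IsFilter (Fα α)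
mainTheorem5 α suitable =
  (λ _ → proj₁) , Fα-nonempty suitable , Fα-upward α , Fα-meet suitable
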